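{- Let $T$ be a tree of order $n\geq 2$ with $\ell$ leaves and $s$ support vertices. Then $$\gamma_{s}(T)\geq \frac{n+4+2(\ell-s)}{3}.$$
   Context: A signed dominating function (SDF) of $T$ is a function $f:V(T)\to\{ -1,1\}$ with $f(N[v])=\sum_{u\in N[v]}f(u)\geq 1$ for every vertex $v$, where $N[v]$ is the closed neighborhood; $\gamma_s(T)$ is the minimum of $\sum_{v} f(v)$ over all SDFs. A leaf is a vertex of degree $1$; a support vertex is a vertex adjacent to a leaf. -}

module Defs where

open import Data.Nat using (ℕ; zero; suc; _≤_)
open import Data.Fin using (Fin; zero; suc)
open import Data.Bool using (Bool; true; false; T; if_then_else_; _∧_)
open import Data.Integer as ℤ using (ℤ; +_; -_)
open import Data.List using (List; []; _∷_; length; last)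
open import Data.List.Relation.Unary.Unique.Propositional using (Unique)
open import Data.Maybe using (Maybe; just; nothing)
open import Data.Product using (Σ; _×_; ∃)
open import Relation.Binary.PropositionalEquality using (_≡_)
open import Relation.Nullary using (¬_)

Graph : ℕ → Set
Graph n = Fin n → Fin n → Bool

IsSimple : ∀ {n} → Graph n → Set
IsSimple {n} G = (∀ (u v : Fin n) → G u v ≡ G v u) × (∀ (v : Fin n) → G v v ≡ false)

data Reach {n} (G : Graph n) : Fin n → Fin n → Set where
  here : ∀ {v} → Reach G v v
  step : ∀ {u w v} → T (G u w) → Reach G w v → Reach G u v

Connected : ∀ {n} → Graph n → Set
Connected {n} G = ∀ (u v : Fin n) → Reach G u v

Chain : ∀ {n} → Graph n → List (Fin n) → Set
Chain G [] = Data.Unit.⊤ where import Data.Unit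
Chain G (x ∷ []) = Data.Unit.⊤ where import Data.Unit
Chain G (x ∷ y ∷ xs) = T (G x y) × Chain G (y ∷ xs)

IsCycle : ∀ {n} → Graph n → Fin n → List (Fin n) → Set
IsCycle G x xs =
  Unique (x ∷ xs) × (2 ≤ length xs) × Chain G (x ∷ xs) ×
  (∀ y → last (x ∷ xs) ≡ just y → T (G y x))

Acyclic : ∀ {n} → Graph n → Set
Acyclic G = ∀ x xs → ¬ IsCycle G x xs

IsTree : ∀ {n} → Graph n → Set
IsTree G = IsSimple G × Connected G × Acyclic G

sumFin : ∀ n → (Fin n → ℤ) → ℤ
sumFin zero f = + 0
sumFin (suc n) f = f zero ℤ.+ sumFin n (λ i → f (suc i))

countFin : ∀ n → (Fin n → Bool) → ℕ
countFin zero p = 0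
countFin (suc n) p = (if p zero then 1 else 0) Data.Nat.+ countFin n (λ i → p (suc i))
  where import Data.Nat

anyFin : ∀ n → (Fin n → Bool) → Bool
anyFin zero p = false
anyFin (suc n) p = if p zero then true else anyFin n (λ i → p (suc i))

degree : ∀ {n} → Graph n → Fin n → ℕ
degree {n} G v = countFin n (G v)

isOne : ℕ → Bool
isOne 1 = true
isOne _ = false

isLeaf : ∀ {n} → Graph n → Fin n → Bool
isLeaf G v = isOne (degree G v)

isSupport : ∀ {n} → Graph n → Fin n → Bool
isSupport {n} G v = anyFin n (λ u → G v u ∧ isLeaf G u)

numLeaves : ∀ {n} → Graph n → ℕ
numLeaves {n} G = countFin n (isLeaf G)

numSupports : ∀ {n} → Graph n → ℕ
numSupports {n} G = countFin n (isSupport G)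

closedNbhdSum : ∀ {n} → Graph n → (Fin n → ℤ) → Fin n → ℤ
closedNbhdSum {n} G f v = f v ℤ.+ sumFin n (λ u → if G v u then f u else + 0)

weight : ∀ {n} → (Fin n → ℤ) → ℤ
weight {n} f = sumFin n f

IsSDF : ∀ {n} → Graph n → (Fin n → ℤ) → Set
IsSDF {n} G f =
  (∀ (v : Fin n) → (f v ≡ + 1) Data.Sum.⊎ (f v ≡ - (+ 1))) ×
  (∀ (v : Fin n) → + 1 ℤ.≤ closedNbhdSum G f v)
  where import Data.Sum

-- Let P and M be the vertices where f is +1 and −1, L ⊆ P the leaves and Q = P ∖ L.
-- The condition f(N[u]) ≥ 1 forces every leaf to be positive with a positive neighbour,
-- every vertex of P to have at least as many positive as negative neighbours, and every
-- vertex of M to have at least two neighbours in Q. Hence each vertex v satisfies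
--   1 + [v ∈ L] + 3 [v ∈ M] ≤ [v is a support vertex] + |N(v) ∩ Q| + [v ∉ Q] deg v,
-- and since Σ_v |N(v) ∩ Q| = Σ_{v ∈ Q} deg v, summing gives n + ℓ + 3|M| ≤ s + Σ_v deg v,
-- which is at most s + 2n − 2 in a tree. With n = |P| + |M| and weight |P| − |M| this is the bound.
module Submission where

open import Data.Bool using (Bool; true; false; T; not; _∧_; if_then_else_)
open import Data.Bool.Properties using (T-≡; ∧-assoc; ∧-identityʳ; ∧-zeroʳ)
open import Data.Empty using (⊥-elim)
open import Data.Fin using (Fin; zero; suc; punchIn)
open import Data.Fin.Properties using (punchIn-injective; punchInᵢ≢i; pigeonhole; _≟_)
open import Data.Integer as ℤ using (ℤ; +_; -_; +≤+)
import Data.Integer.Properties as ℤ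
open import Data.Integer.Tactic.RingSolver using (solve-∀)
open import Data.List using (List; []; _∷_; length; last; map; lookup)
open import Data.List.Properties using (length-map; last-map)
open import Data.List.Membership.Propositional using (_∈_)
open import Data.List.Membership.Propositional.Properties using (∈-lookup)
open import Data.List.Relation.Unary.All as All using (All; []; _∷_)
open import Data.List.Relation.Unary.All.Properties using (¬Any⇒All¬)
open import Data.List.Relation.Unary.AllPairs using ([]; _∷_)
open import Data.List.Relation.Unary.Any using (here; there)
open import Data.List.Relation.Unary.Unique.Propositional using (Unique)
import Data.List.Relation.Unary.Unique.Propositional.Properties as Unique
open import Data.Maybe using (just)
open import Data.Nat using (ℕ; zero; suc; _+_; _*_; _≤_; z≤n; s≤s; _≤?_)
open import Data.Nat.Properties hiding (_≟_)
open import Algebra.Properties.Semiring.Sum +-*-semiring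
  using (sum; sum-cong-≗; ∑-distrib-+; ∑-comm; sum-remove; *-distribˡ-sum)
open import Data.Nat.Tactic.RingSolver as ℕ-Solver using ()
open import Data.Product using (∃; _×_; _,_; proj₁; proj₂)
open import Data.Sum using (inj₁; inj₂)
open import Data.Unit using (tt)
open import Function using (_∘_; Equivalence)
open import Relation.Binary.PropositionalEquality
open import Relation.Nullary using (yes; no; does)

open import Defs

-- Counting over Fin n

𝟙 : Bool → ℕ
𝟙 b = if b then 1 else 0

𝟙≤1 : ∀ b → 𝟙 b ≤ 1
𝟙≤1 true  = ≤-refl
𝟙≤1 false = z≤n

𝟙-∧ : ∀ a b → 𝟙 (a ∧ b) ≡ 𝟙 a * 𝟙 b
𝟙-∧ true  true  = refl
𝟙-∧ true  false = refl
𝟙-∧ false b     = refl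

𝟙-*-partition : ∀ b d → 𝟙 b * d + 𝟙 (not b) * d ≡ d
𝟙-*-partition true  d = trans (+-identityʳ (1 * d)) (*-identityˡ d)
𝟙-*-partition false d = *-identityˡ d

sum-mono-≤ : ∀ {n} {g h : Fin n → ℕ} → (∀ i → g i ≤ h i) → sum g ≤ sum h
sum-mono-≤ {zero}  g≤h = z≤n
sum-mono-≤ {suc n} g≤h = +-mono-≤ (g≤h zero) (sum-mono-≤ (g≤h ∘ suc))

sum-ones : ∀ n → sum {n} (λ _ → 1) ≡ n
sum-ones zero    = refl
sum-ones (suc n) = cong suc (sum-ones n)

countFin≡sum : ∀ n (p : Fin n → Bool) → countFin n p ≡ sum (𝟙 ∘ p)
countFin≡sum zero    p = refl
countFin≡sum (suc n) p = cong (_+_ (𝟙 (p zero))) (countFin≡sum n (p ∘ suc))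

countFin-cong : ∀ n {p q : Fin n → Bool} → (∀ u → p u ≡ q u) → countFin n p ≡ countFin n q
countFin-cong zero    p≗q = refl
countFin-cong (suc n) p≗q = cong₂ _+_ (cong 𝟙 (p≗q zero)) (countFin-cong n (p≗q ∘ suc))

countFin-false : ∀ n {p : Fin n → Bool} → (∀ u → p u ≡ false) → countFin n p ≡ 0
countFin-false zero    p≗false = refl
countFin-false (suc n) p≗false rewrite p≗false zero = countFin-false n (p≗false ∘ suc)

countFin-split : ∀ n (p q : Fin n → Bool) →
  countFin n p ≡ countFin n (λ u → p u ∧ q u) + countFin n (λ u → p u ∧ not (q u))
countFin-split n p q = begin
  countFin n p                           ≡⟨ countFin≡sum n p ⟩
  sum (𝟙 ∘ p)                            ≡⟨ sum-cong-≗ (λ u → 𝟙-split (p u) (q u)) ⟩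
  sum (λ u → 𝟙 (both u) + 𝟙 (only-p u))  ≡⟨ ∑-distrib-+ (𝟙 ∘ both) (𝟙 ∘ only-p) ⟩
  sum (𝟙 ∘ both) + sum (𝟙 ∘ only-p)      ≡⟨ sym (cong₂ _+_ (countFin≡sum n both) (countFin≡sum n only-p)) ⟩
  countFin n both + countFin n only-p    ∎
  where
  open ≡-Reasoning
  both only-p : Fin n → Bool
  both u = p u ∧ q u
  only-p u = p u ∧ not (q u)
  𝟙-split : ∀ a b → 𝟙 a ≡ 𝟙 (a ∧ b) + 𝟙 (a ∧ not b)
  𝟙-split true  true  = refl
  𝟙-split true  false = refl
  𝟙-split false b     = refl

countFin-remove : ∀ n (p : Fin (suc n) → Bool) v →
  countFin (suc n) p ≡ 𝟙 (p v) + countFin n (p ∘ punchIn v)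
countFin-remove n p v = begin
  countFin (suc n) p                       ≡⟨ countFin≡sum (suc n) p ⟩
  sum (𝟙 ∘ p)                              ≡⟨ sum-remove (𝟙 ∘ p) ⟩
  𝟙 (p v) + sum (𝟙 ∘ p ∘ punchIn v)        ≡⟨ cong (_+_ (𝟙 (p v))) (sym (countFin≡sum n _)) ⟩
  𝟙 (p v) + countFin n (p ∘ punchIn v)     ∎
  where open ≡-Reasoning

countFin-positive : ∀ n (p : Fin n → Bool) u → p u ≡ true → 1 ≤ countFin n p
countFin-positive (suc n) p u pu rewrite countFin-remove n p u | pu = s≤s z≤n

countFin-witness : ∀ n (p : Fin n → Bool) → 1 ≤ countFin n p → ∃ λ u → p u ≡ true
countFin-witness (suc n) p 1≤count with p zero in p0
... | true  = zero , p0
... | false = let u , pu = countFin-witness n (p ∘ suc) 1≤count in suc u , pu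

countFin-witness-avoiding : ∀ n (p : Fin (suc n) → Bool) z → 2 ≤ countFin (suc n) p →
  ∃ λ y → p y ≡ true × y ≢ z
countFin-witness-avoiding n p z 2≤count =
  let y , py = countFin-witness n (p ∘ punchIn z) 1≤rest in punchIn z y , py , punchInᵢ≢i z y
  where
  1≤rest : 1 ≤ countFin n (p ∘ punchIn z)
  1≤rest = +-cancelˡ-≤ 1 1 _ (≤-trans (subst (2 ≤_) (countFin-remove n p z) 2≤count)
                                      (+-monoˡ-≤ _ (𝟙≤1 (p z))))

anyFin-complete : ∀ n (p : Fin n → Bool) → 1 ≤ countFin n p → anyFin n p ≡ true
anyFin-complete (suc n) p 1≤count with p zero
... | true  = refl
... | false = anyFin-complete n (p ∘ suc) 1≤count

sumFin-cong : ∀ n {g h : Fin n → ℤ} → (∀ i → g i ≡ h i) → sumFin n g ≡ sumFin n h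
sumFin-cong zero    g≗h = refl
sumFin-cong (suc n) g≗h = cong₂ ℤ._+_ (g≗h zero) (sumFin-cong n (g≗h ∘ suc))

sign : Bool → ℤ
sign c = if c then + 1 else - + 1

sumFin-sign : ∀ n (b c : Fin n → Bool) →
  sumFin n (λ u → if b u then sign (c u) else + 0)
    ≡ + countFin n (λ u → b u ∧ c u) ℤ.- + countFin n (λ u → b u ∧ not (c u))
sumFin-sign zero b c = refl
sumFin-sign (suc n) b c rewrite sumFin-sign n (b ∘ suc) (c ∘ suc) with b zero | c zero
... | true  | true  = plus-one (+ countFin n _) (+ countFin n _)
  where
  plus-one : ∀ x y → + 1 ℤ.+ (x ℤ.- y) ≡ (+ 1 ℤ.+ x) ℤ.- y
  plus-one = solve-∀
... | true  | false = minus-one (+ countFin n _) (+ countFin n _)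
  where
  minus-one : ∀ x y → - + 1 ℤ.+ (x ℤ.- y) ≡ x ℤ.- (+ 1 ℤ.+ y)
  minus-one = solve-∀
... | false | _     = ℤ.+-identityˡ _

-- Degree sums

Symmetric : ∀ {n} → Graph n → Set
Symmetric {n} G = ∀ (u v : Fin n) → G u v ≡ G v u

neighbours : ∀ {n} → Graph n → (Fin n → Bool) → Fin n → ℕ
neighbours {n} G X v = countFin n (λ u → G v u ∧ X u)

sum-neighbours : ∀ {n} (G : Graph n) → Symmetric G → (X : Fin n → Bool) →
  sum (neighbours G X) ≡ sum (λ v → 𝟙 (X v) * degree G v)
sum-neighbours {n} G G-sym X = begin
  sum (λ v → countFin n (λ u → G v u ∧ X u))
    ≡⟨ sum-cong-≗ (λ v → countFin≡sum n (λ u → G v u ∧ X u)) ⟩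
  sum (λ v → sum (λ u → 𝟙 (G v u ∧ X u)))
    ≡⟨ ∑-comm (λ v u → 𝟙 (G v u ∧ X u)) ⟩
  sum (λ u → sum (λ v → 𝟙 (G v u ∧ X u)))
    ≡⟨ sum-cong-≗ (λ u → sum-cong-≗ (λ v → edge u v)) ⟩
  sum (λ u → sum (λ v → 𝟙 (X u) * 𝟙 (G u v)))
    ≡⟨ sum-cong-≗ (λ u → sym (*-distribˡ-sum (𝟙 (X u)) (𝟙 ∘ G u))) ⟩
  sum (λ u → 𝟙 (X u) * sum (𝟙 ∘ G u))
    ≡⟨ sum-cong-≗ (λ u → cong (𝟙 (X u) *_) (sym (countFin≡sum n (G u)))) ⟩
  sum (λ u → 𝟙 (X u) * degree G u) ∎
  where
  open ≡-Reasoning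
  edge : ∀ u v → 𝟙 (G v u ∧ X u) ≡ 𝟙 (X u) * 𝟙 (G u v)
  edge u v rewrite G-sym v u = trans (𝟙-∧ (G u v) (X u)) (*-comm (𝟙 (G u v)) (𝟙 (X u)))

deleteVertex : ∀ {n} → Graph (suc n) → Fin (suc n) → Graph n
deleteVertex G v i j = G (punchIn v i) (punchIn v j)

deleteVertex-simple : ∀ {n} (G : Graph (suc n)) v → IsSimple G → IsSimple (deleteVertex G v)
deleteVertex-simple G v (G-sym , G-irrefl) =
  (λ i j → G-sym (punchIn v i) (punchIn v j)) , (λ i → G-irrefl (punchIn v i))

chain-punchIn : ∀ {n} (G : Graph (suc n)) v (xs : List (Fin n)) →
  Chain (deleteVertex G v) xs → Chain G (map (punchIn v) xs)
chain-punchIn G v []           _         = tt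
chain-punchIn G v (x ∷ [])     _         = tt
chain-punchIn G v (x ∷ y ∷ xs) (xy , ch) = xy , chain-punchIn G v (y ∷ xs) ch

deleteVertex-acyclic : ∀ {n} (G : Graph (suc n)) v → Acyclic G → Acyclic (deleteVertex G v)
deleteVertex-acyclic G v acyclic x xs (unique , 2≤len , chain , closing) =
  acyclic (punchIn v x) (map (punchIn v) xs)
    ( Unique.map⁺ (punchIn-injective v _ _) unique
    , subst (2 ≤_) (sym (length-map (punchIn v) xs)) 2≤len
    , chain-punchIn G v (x ∷ xs) chain
    , closing′ )
  where
  closing′ : ∀ y → last (map (punchIn v) (x ∷ xs)) ≡ just y → T (G y (punchIn v x))
  closing′ y last≡y with last (x ∷ xs) | trans (sym (last-map (punchIn v) (x ∷ xs))) last≡y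
  ... | just y′ | refl = closing y′ refl

degree-sum-deleteVertex : ∀ {n} (G : Graph (suc n)) v → IsSimple G →
  sum (degree G) ≡ 2 * degree G v + sum (degree (deleteVertex G v))
degree-sum-deleteVertex {n} G v (G-sym , G-irrefl) = begin
  sum (degree G)
    ≡⟨ sum-remove (degree G) ⟩
  degree G v + sum (degree G ∘ punchIn v)
    ≡⟨ cong (_+_ (degree G v)) (sum-cong-≗ (λ i → countFin-remove n (G (punchIn v i)) v)) ⟩
  degree G v + sum (λ i → 𝟙 (G (punchIn v i) v) + degree G′ i)
    ≡⟨ cong (_+_ (degree G v)) (∑-distrib-+ (λ i → 𝟙 (G (punchIn v i) v)) (degree G′)) ⟩
  degree G v + (sum (λ i → 𝟙 (G (punchIn v i) v)) + sum (degree G′))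
    ≡⟨ cong (λ d → degree G v + (d + sum (degree G′))) edges-at-v ⟩
  degree G v + (degree G v + sum (degree G′))
    ≡⟨ double (degree G v) (sum (degree G′)) ⟩
  2 * degree G v + sum (degree G′) ∎
  where
  open ≡-Reasoning
  G′ = deleteVertex G v
  double : ∀ d s → d + (d + s) ≡ 2 * d + s
  double = ℕ-Solver.solve-∀
  edges-at-v : sum (λ i → 𝟙 (G (punchIn v i) v)) ≡ degree G v
  edges-at-v = begin
    sum (λ i → 𝟙 (G (punchIn v i) v))    ≡⟨ sum-cong-≗ (λ i → cong 𝟙 (G-sym (punchIn v i) v)) ⟩
    sum (λ i → 𝟙 (G v (punchIn v i)))    ≡⟨ sym (countFin≡sum n _) ⟩
    countFin n (G v ∘ punchIn v)         ≡⟨ cong (_+ countFin n (G v ∘ punchIn v)) (cong 𝟙 (sym (G-irrefl v))) ⟩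
    𝟙 (G v v) + countFin n (G v ∘ punchIn v) ≡⟨ sym (countFin-remove n (G v) v) ⟩
    degree G v                           ∎

unique-length≤ : ∀ {m} (xs : List (Fin m)) → Unique xs → length xs ≤ m
unique-length≤ {m} xs unique with length xs ≤? m
... | yes len≤m = len≤m
... | no  len≰m =
  let i , j , i<j , lookup≡ = pigeonhole (≰⇒> len≰m) (lookup xs)
  in ⊥-elim (lookup-distinct xs unique i<j lookup≡)
  where
  lookup-distinct : ∀ {A : Set} (xs : List A) → Unique xs → ∀ {i j} → i Data.Fin.< j →
    lookup xs i ≢ lookup xs j
  lookup-distinct (x ∷ xs) (x∉xs ∷ _) {zero}  {suc j} _         = All.lookup x∉xs (∈-lookup j)
  lookup-distinct (x ∷ xs) (_ ∷ unique) {suc i} {suc j} (s≤s i<j) = lookup-distinct xs unique i<j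

module _ {A : Set} where

  takeThrough : ∀ {y : A} {xs} → y ∈ xs → List A
  takeThrough {y} (here _)  = y ∷ []
  takeThrough {xs = x ∷ _} (there y∈xs) = x ∷ takeThrough y∈xs

  takeThrough-all : ∀ {P : A → Set} {y xs} (y∈xs : y ∈ xs) → All P xs → All P (takeThrough y∈xs)
  takeThrough-all (here refl)  (py ∷ _)  = py ∷ []
  takeThrough-all (there y∈xs) (px ∷ ps) = px ∷ takeThrough-all y∈xs ps

  takeThrough-unique : ∀ {y xs} (y∈xs : y ∈ xs) → Unique xs → Unique (takeThrough y∈xs)
  takeThrough-unique (here refl)  (_ ∷ _)          = [] ∷ []
  takeThrough-unique (there y∈xs) (x∉xs ∷ unique) =
    takeThrough-all y∈xs x∉xs ∷ takeThrough-unique y∈xs unique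

  takeThrough-last : ∀ {y xs} (y∈xs : y ∈ xs) → last (takeThrough y∈xs) ≡ just y
  takeThrough-last (here refl)          = refl
  takeThrough-last (there (here refl))  = refl
  takeThrough-last (there (there y∈xs)) = takeThrough-last (there y∈xs)

takeThrough-chain : ∀ {n} (G : Graph n) {y xs} (y∈xs : y ∈ xs) → Chain G xs → Chain G (takeThrough y∈xs)
takeThrough-chain G (here refl)          _         = tt
takeThrough-chain G (there (here refl))  (xy , _)  = xy , tt
takeThrough-chain G (there (there y∈xs)) (xz , ch) = xz , takeThrough-chain G (there y∈xs) ch

module LongestPath {n} (G : Graph (suc n)) (simple : IsSimple G) (acyclic : Acyclic G) where

  open import Data.List.Membership.DecPropositional (_≟_ {suc n}) using (_∈?_)

  private
    Path : List (Fin (suc n)) → Set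
    Path xs = Unique xs × Chain G xs

  adjacent-sym : ∀ {x y} → G x y ≡ true → T (G y x)
  adjacent-sym {x} {y} xy = Equivalence.from T-≡ (trans (proj₁ simple y x) xy)

  adjacent-distinct : ∀ {x y} → G x y ≡ true → y ≢ x
  adjacent-distinct {x} xy refl with trans (sym xy) (proj₂ simple x)
  ... | ()

  chord-cycle : ∀ {x z y rest} → Path (x ∷ z ∷ rest) → G x y ≡ true → (y∈rest : y ∈ rest) →
    IsCycle G x (z ∷ takeThrough y∈rest)
  chord-cycle {x} {z} (unique , chain) xy y∈rest =
      takeThrough-unique (there (there y∈rest)) unique
    , s≤s (nonempty y∈rest)
    , takeThrough-chain G (there (there y∈rest)) chain
    , closing
    where
    nonempty : ∀ {y : Fin (suc n)} {ys} (p : y ∈ ys) → 1 ≤ length (takeThrough p)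
    nonempty (here _)  = s≤s z≤n
    nonempty (there _) = s≤s z≤n
    closing : ∀ y′ → last (x ∷ z ∷ takeThrough y∈rest) ≡ just y′ → T (G y′ x)
    closing y′ last≡y′ with trans (sym (takeThrough-last {xs = x ∷ z ∷ _} (there (there y∈rest)))) last≡y′
    ... | refl = adjacent-sym xy

  -- The fuel only ensures termination: a path has at most suc n vertices.
  extend : (fuel : ℕ) (x z : Fin (suc n)) (rest : List (Fin (suc n))) → Path (x ∷ z ∷ rest) →
    suc (suc n) ≤ fuel + length (x ∷ z ∷ rest) → ∃ λ v → degree G v ≤ 1
  extend zero x z rest (unique , _) bound =
    ⊥-elim (1+n≰n (≤-trans bound (unique-length≤ (x ∷ z ∷ rest) unique)))
  extend (suc fuel) x z rest path@(unique , chain) bound with degree G x ≤? 1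
  ... | yes deg≤1 = x , deg≤1
  ... | no  deg≰1 with countFin-witness-avoiding n (G x) z (≰⇒> deg≰1)
  ... | y , xy , y≢z with y ∈? rest
  ...   | yes y∈rest = ⊥-elim (acyclic x _ (chord-cycle path xy y∈rest))
  ...   | no  y∉rest = extend fuel y x (z ∷ rest)
          ((adjacent-distinct xy ∷ y≢z ∷ ¬Any⇒All¬ rest y∉rest) ∷ unique , adjacent-sym xy , chain)
          (subst (suc (suc n) ≤_) (sym (+-suc fuel _)) bound)

  degree≤1-vertex : ∃ λ v → degree G v ≤ 1
  degree≤1-vertex with degree G zero ≤? 1
  ... | yes deg≤1 = zero , deg≤1
  ... | no  deg≰1 with countFin-witness-avoiding n (G zero) zero (≰⇒> deg≰1)
  ... | y , 0y , y≢0 =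
    extend (suc n) y zero [] ((y≢0 ∷ []) ∷ [] ∷ [] , adjacent-sym 0y , tt)
      (≤-trans (n≤1+n _) (≤-reflexive (sym (+-comm (suc n) 2))))

degree-sum-acyclic : ∀ n (G : Graph (suc n)) → IsSimple G → Acyclic G → sum (degree G) + 2 ≤ 2 * suc n
degree-sum-acyclic zero    G (_ , G-irrefl) _ rewrite G-irrefl zero = ≤-refl
degree-sum-acyclic (suc n) G simple acyclic =
  let v , deg≤1 = LongestPath.degree≤1-vertex G simple acyclic
      G′        = deleteVertex G v
      ih        = degree-sum-acyclic n G′ (deleteVertex-simple G v simple) (deleteVertex-acyclic G v acyclic)
  in begin
    sum (degree G) + 2                     ≡⟨ cong (_+ 2) (degree-sum-deleteVertex G v simple) ⟩
    2 * degree G v + sum (degree G′) + 2   ≡⟨ +-assoc (2 * degree G v) _ 2 ⟩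
    2 * degree G v + (sum (degree G′) + 2) ≤⟨ +-mono-≤ (*-monoʳ-≤ 2 deg≤1) ih ⟩
    2 * 1 + 2 * suc n                      ≡⟨ sym (*-distribˡ-+ 2 1 (suc n)) ⟩
    2 * suc (suc n)                        ∎
  where open ≤-Reasoning

connected⇒degree≥1 : ∀ {n} (G : Graph n) → Connected G → ∀ {u v} → u ≢ v → 1 ≤ degree G v
connected⇒degree≥1 {n} G connected {u} {v} u≢v with connected v u
... | here          = ⊥-elim (u≢v refl)
... | step {w = w} vw _ = countFin-positive n (G v) w (Equivalence.to T-≡ vw)

-- Signed dominating functions

1≤1+p-m⇒m≤p : ∀ p m → + 1 ℤ.≤ + 1 ℤ.+ (+ p ℤ.- + m) → m ≤ p
1≤1+p-m⇒m≤p p m h = ≤-pred (ℤ.drop‿+≤+ (ℤ.≤-trans (ℤ.+-monoˡ-≤ (+ m) h)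
                                                   (ℤ.≤-reflexive (cancel (+ p) (+ m)))))
  where
  cancel : ∀ p m → + 1 ℤ.+ (p ℤ.- m) ℤ.+ m ≡ + 1 ℤ.+ p
  cancel = solve-∀

1≤-1+p-m⇒2+m≤p : ∀ p m → + 1 ℤ.≤ - + 1 ℤ.+ (+ p ℤ.- + m) → 2 + m ≤ p
1≤-1+p-m⇒2+m≤p p m h = ℤ.drop‿+≤+ (ℤ.≤-trans (ℤ.+-monoˡ-≤ (+ 1 ℤ.+ + m) h)
                                              (ℤ.≤-reflexive (cancel (+ p) (+ m))))
  where
  cancel : ∀ p m → - + 1 ℤ.+ (p ℤ.- m) ℤ.+ (+ 1 ℤ.+ m) ≡ p
  cancel = solve-∀

module SignedDominating {n} (G : Graph n) (G-sym : Symmetric G)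
  (no-isolated : ∀ v → 1 ≤ degree G v) {f : Fin n → ℤ} (sdf : IsSDF G f) where

  positive : Fin n → Bool
  positive u = does (f u ℤ.≟ + 1)

  f≡sign : ∀ u → f u ≡ sign (positive u)
  f≡sign u with f u ℤ.≟ + 1 | proj₁ sdf u
  ... | yes fu≡1 | _         = fu≡1
  ... | no  fu≢1 | inj₁ fu≡1 = ⊥-elim (fu≢1 fu≡1)
  ... | no  _    | inj₂ fu≡-1 = fu≡-1

  leaf inner : Fin n → Bool
  leaf = isLeaf G
  inner u = positive u ∧ not (leaf u)

  positiveNbrs negativeNbrs : Fin n → ℕ
  positiveNbrs = neighbours G positive
  negativeNbrs = neighbours G (not ∘ positive)

  degree-split : ∀ v → degree G v ≡ positiveNbrs v + negativeNbrs v
  degree-split v = countFin-split n (G v) positive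

  nbrSum : Fin n → ℤ
  nbrSum v = + positiveNbrs v ℤ.- + negativeNbrs v

  closedNbhdSum-sign : ∀ v → closedNbhdSum G f v ≡ f v ℤ.+ nbrSum v
  closedNbhdSum-sign v = cong (ℤ._+_ (f v)) (trans (sumFin-cong n nbr-value) (sumFin-sign n (G v) positive))
    where
    nbr-value : ∀ u → (if G v u then f u else + 0) ≡ (if G v u then sign (positive u) else + 0)
    nbr-value u with G v u
    ... | true  = f≡sign u
    ... | false = refl

  balance : ∀ v {b} → positive v ≡ b → + 1 ℤ.≤ sign b ℤ.+ nbrSum v
  balance v refl = subst (λ t → + 1 ℤ.≤ t ℤ.+ nbrSum v) (f≡sign v)
                         (subst (+ 1 ℤ.≤_) (closedNbhdSum-sign v) (proj₂ sdf v))

  positive-balance : ∀ v → positive v ≡ true → negativeNbrs v ≤ positiveNbrs v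
  positive-balance v pv = 1≤1+p-m⇒m≤p _ _ (balance v pv)

  negative-balance : ∀ v → positive v ≡ false → 2 + negativeNbrs v ≤ positiveNbrs v
  negative-balance v nv = 1≤-1+p-m⇒2+m≤p _ _ (balance v nv)

  negative-degree : ∀ v → positive v ≡ false → 2 ≤ degree G v
  negative-degree v nv = begin
    2                                   ≤⟨ m≤m+n 2 _ ⟩
    2 + negativeNbrs v                  ≤⟨ negative-balance v nv ⟩
    positiveNbrs v                      ≤⟨ m≤m+n _ _ ⟩
    positiveNbrs v + negativeNbrs v     ≡⟨ sym (degree-split v) ⟩
    degree G v                          ∎
    where open ≤-Reasoning

  leaf-degree : ∀ v → leaf v ≡ true → degree G v ≡ 1
  leaf-degree v = isOne-true (degree G v)
    where
    isOne-true : ∀ k → isOne k ≡ true → k ≡ 1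
    isOne-true 1 _ = refl

  leaf-positive : ∀ v → leaf v ≡ true → positive v ≡ true
  leaf-positive v lv with positive v in pv
  ... | true  = refl
  ... | false with s≤s () ← ≤-trans (negative-degree v pv) (≤-reflexive (leaf-degree v lv))

  leaf-negativeNbrs : ∀ u → leaf u ≡ true → negativeNbrs u ≡ 0
  leaf-negativeNbrs u lu =
    minority (positive-balance u (leaf-positive u lu)) (trans (sym (degree-split u)) (leaf-degree u lu))
    where
    minority : ∀ {a b} → b ≤ a → a + b ≡ 1 → b ≡ 0
    minority {b = zero}        _       _   = refl
    minority {suc a} {suc b} (s≤s _) a+b≡1 with () ← trans (sym (+-suc a b)) (suc-injective a+b≡1)

  negative-no-leaf-neighbour : ∀ w u → positive w ≡ false → G w u ≡ true → leaf u ≡ false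
  negative-no-leaf-neighbour w u nw wu with leaf u in lu
  ... | false = refl
  ... | true  with () ← subst (1 ≤_) (leaf-negativeNbrs u lu)
                          (countFin-positive n _ w (cong₂ (λ a b → a ∧ not b) (trans (G-sym u w) wu) nw))

  positiveNbrs-split : ∀ v → positiveNbrs v ≡ neighbours G leaf v + neighbours G inner v
  positiveNbrs-split v = trans (countFin-split n (λ u → G v u ∧ positive u) leaf)
    (cong₂ _+_ (countFin-cong n leaf-part) (countFin-cong n (λ u → ∧-assoc (G v u) _ _)))
    where
    leaf-part : ∀ u → (G v u ∧ positive u) ∧ leaf u ≡ G v u ∧ leaf u
    leaf-part u with leaf u in lu
    ... | true  rewrite leaf-positive u lu = cong (_∧ true) (∧-identityʳ (G v u))
    ... | false = trans (∧-zeroʳ _) (sym (∧-zeroʳ _))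

  positive-charge : ∀ v → positive v ≡ true → 1 ≤ 𝟙 (isSupport G v) + neighbours G inner v
  positive-charge v pv = leaf-or-inner 1≤pos
    (λ 1≤leafNbrs → ≤-reflexive (cong 𝟙 (sym (anyFin-complete n _ 1≤leafNbrs))))
    where
    1≤pos : 1 ≤ neighbours G leaf v + neighbours G inner v
    1≤pos = subst (1 ≤_) (positiveNbrs-split v)
      (half (positive-balance v pv) (subst (1 ≤_) (degree-split v) (no-isolated v)))
      where
      half : ∀ {a b} → b ≤ a → 1 ≤ a + b → 1 ≤ a
      half {zero}  z≤n ()
      half {suc a} _   _ = s≤s z≤n
    leaf-or-inner : ∀ {a b c} → 1 ≤ a + b → (1 ≤ a → 1 ≤ c) → 1 ≤ c + b
    leaf-or-inner {zero}  {b} {c} 1≤b _  = ≤-trans 1≤b (m≤n+m b c)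
    leaf-or-inner {suc a} {b} {c} _   ⇒c = ≤-trans (⇒c (s≤s z≤n)) (m≤m+n c b)

  negative-innerNbrs : ∀ v → positive v ≡ false → 2 ≤ neighbours G inner v
  negative-innerNbrs v nv = begin
    2                                                 ≤⟨ m≤m+n 2 _ ⟩
    2 + negativeNbrs v                                ≤⟨ negative-balance v nv ⟩
    positiveNbrs v                                    ≡⟨ positiveNbrs-split v ⟩
    neighbours G leaf v + neighbours G inner v        ≡⟨ cong (_+ neighbours G inner v) no-leaf-nbrs ⟩
    neighbours G inner v                              ∎
    where
    open ≤-Reasoning
    no-leaf-nbrs : neighbours G leaf v ≡ 0
    no-leaf-nbrs = countFin-false n λ u → lemma u (G v u) refl
      where
      lemma : ∀ u b → G v u ≡ b → b ∧ leaf u ≡ false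
      lemma u true  vu = cong (true ∧_) (negative-no-leaf-neighbour v u nv vu)
      lemma u false _  = refl

  charge : ∀ v → 3 * 𝟙 (not (positive v)) + 𝟙 (leaf v) + 1
    ≤ 𝟙 (isSupport G v) + neighbours G inner v + 𝟙 (not (inner v)) * degree G v
  charge v with positive v in pv | leaf v in lv
  ... | true  | true  =
    +-mono-≤ (positive-charge v pv) (subst (1 ≤_) (sym (*-identityˡ _)) (no-isolated v))
  ... | true  | false = ≤-trans (positive-charge v pv) (m≤m+n _ _)
  ... | false | true  with () ← trans (sym (leaf-positive v lv)) pv
  ... | false | false =
    ≤-trans (+-mono-≤ (negative-innerNbrs v pv) (subst (2 ≤_) (sym (*-identityˡ _)) (negative-degree v pv)))
            (+-monoˡ-≤ _ (m≤n+m _ (𝟙 (isSupport G v))))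

  P M : ℕ
  P = countFin n positive
  M = countFin n (not ∘ positive)

  vertex-count : n ≡ P + M
  vertex-count = begin
    n                          ≡⟨ sym (sum-ones n) ⟩
    sum (λ (_ : Fin n) → 1)    ≡⟨ sym (countFin≡sum n (λ _ → true)) ⟩
    countFin n (λ _ → true)    ≡⟨ countFin-split n (λ _ → true) positive ⟩
    P + M                      ∎
    where open ≡-Reasoning

  weight-count : weight f ≡ + P ℤ.- + M
  weight-count = trans (sumFin-cong n f≡sign) (sumFin-sign n (λ _ → true) positive)

  charge-sum : 3 * M + numLeaves G + n ≤ numSupports G + sum (degree G)
  charge-sum = subst₂ _≤_ total-charge total-budget (sum-mono-≤ charge)
    where
    open ≡-Reasoning
    outer : Fin n → ℕ
    outer v = 𝟙 (not (inner v)) * degree G v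
    total-charge : sum (λ v → 3 * 𝟙 (not (positive v)) + 𝟙 (leaf v) + 1) ≡ 3 * M + numLeaves G + n
    total-charge = begin
      sum (λ v → 3 * 𝟙 (not (positive v)) + 𝟙 (leaf v) + 1)
        ≡⟨ ∑-distrib-+ (λ v → 3 * 𝟙 (not (positive v)) + 𝟙 (leaf v)) (λ (_ : Fin n) → 1) ⟩
      sum (λ v → 3 * 𝟙 (not (positive v)) + 𝟙 (leaf v)) + sum (λ (_ : Fin n) → 1)
        ≡⟨ cong₂ _+_ (∑-distrib-+ (λ v → 3 * 𝟙 (not (positive v))) (𝟙 ∘ leaf)) (sum-ones n) ⟩
      sum (λ v → 3 * 𝟙 (not (positive v))) + sum (𝟙 ∘ leaf) + n
        ≡⟨ cong (λ t → t + sum (𝟙 ∘ leaf) + n) (sym (*-distribˡ-sum 3 (𝟙 ∘ not ∘ positive))) ⟩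
      3 * sum (𝟙 ∘ not ∘ positive) + sum (𝟙 ∘ leaf) + n
        ≡⟨ sym (cong₂ (λ a b → 3 * a + b + n) (countFin≡sum n _) (countFin≡sum n _)) ⟩
      3 * M + numLeaves G + n ∎
    total-budget : sum (λ v → 𝟙 (isSupport G v) + neighbours G inner v + 𝟙 (not (inner v)) * degree G v)
                 ≡ numSupports G + sum (degree G)
    total-budget = begin
      sum (λ v → 𝟙 (isSupport G v) + neighbours G inner v + 𝟙 (not (inner v)) * degree G v)
        ≡⟨ ∑-distrib-+ (λ v → 𝟙 (isSupport G v) + neighbours G inner v) outer ⟩
      sum (λ v → 𝟙 (isSupport G v) + neighbours G inner v) + sum outer
        ≡⟨ cong (_+ sum outer) (∑-distrib-+ (𝟙 ∘ isSupport G) (neighbours G inner)) ⟩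
      sum (𝟙 ∘ isSupport G) + sum (neighbours G inner) + sum outer
        ≡⟨ cong₂ (λ a b → a + b + sum outer) (sym (countFin≡sum n _)) (sum-neighbours G G-sym inner) ⟩
      numSupports G + sum (λ v → 𝟙 (inner v) * degree G v) + sum outer
        ≡⟨ +-assoc (numSupports G) _ _ ⟩
      numSupports G + (sum (λ v → 𝟙 (inner v) * degree G v) + sum outer)
        ≡⟨ cong (_+_ (numSupports G)) (sym (∑-distrib-+ (λ v → 𝟙 (inner v) * degree G v) outer)) ⟩
      numSupports G + sum (λ v → 𝟙 (inner v) * degree G v + 𝟙 (not (inner v)) * degree G v)
        ≡⟨ cong (_+_ (numSupports G)) (sum-cong-≗ (λ v → 𝟙-*-partition (inner v) (degree G v))) ⟩
      numSupports G + sum (degree G) ∎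

  support-bound : sum (degree G) + 2 ≤ 2 * n → 2 * M + numLeaves G + 2 ≤ numSupports G + P
  support-bound degrees = +-cancelʳ-≤ (P + 2 * M) _ _ (begin
    2 * M + ℓ + 2 + (P + 2 * M)    ≡⟨ lhs P M ℓ ⟩
    3 * M + ℓ + (P + M) + 2        ≡⟨ cong (λ k → 3 * M + ℓ + k + 2) (sym vertex-count) ⟩
    3 * M + ℓ + n + 2              ≤⟨ +-monoˡ-≤ 2 charge-sum ⟩
    s + sum (degree G) + 2         ≡⟨ +-assoc s _ 2 ⟩
    s + (sum (degree G) + 2)       ≤⟨ +-monoʳ-≤ s degrees ⟩
    s + 2 * n                      ≡⟨ cong (λ k → s + 2 * k) vertex-count ⟩
    s + 2 * (P + M)                ≡⟨ rhs P M s ⟩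
    s + P + (P + 2 * M)            ∎)
    where
    open ≤-Reasoning
    ℓ = numLeaves G
    s = numSupports G
    lhs : ∀ P M ℓ → 2 * M + ℓ + 2 + (P + 2 * M) ≡ 3 * M + ℓ + (P + M) + 2
    lhs = ℕ-Solver.solve-∀
    rhs : ∀ P M s → s + 2 * (P + M) ≡ s + P + (P + 2 * M)
    rhs = ℕ-Solver.solve-∀

signed-bound : ∀ P M ℓ s → 2 * M + ℓ + 2 ≤ s + P →
  + (P + M) ℤ.+ + 4 ℤ.+ + 2 ℤ.* (+ ℓ ℤ.- + s) ℤ.≤ + 3 ℤ.* (+ P ℤ.- + M)
signed-bound P M ℓ s h = begin
  + P ℤ.+ + M ℤ.+ + 4 ℤ.+ + 2 ℤ.* (+ ℓ ℤ.- + s)              ≡⟨ lhs (+ P) (+ M) (+ ℓ) (+ s) ⟩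
  X ℤ.+ + 2 ℤ.* (+ 2 ℤ.* + M ℤ.+ + ℓ ℤ.+ + 2)                ≤⟨ ℤ.+-monoʳ-≤ X (ℤ.*-monoˡ-≤-nonNeg (+ 2) h′) ⟩
  X ℤ.+ + 2 ℤ.* (+ s ℤ.+ + P)                                 ≡⟨ rhs (+ P) (+ M) (+ s) ⟩
  + 3 ℤ.* (+ P ℤ.- + M)                                       ∎
  where
  open ℤ.≤-Reasoning
  -- Both sides of the goal are X plus twice the corresponding side of h.
  X : ℤ
  X = + P ℤ.- + 3 ℤ.* + M ℤ.- + 2 ℤ.* + s
  h′ : + 2 ℤ.* + M ℤ.+ + ℓ ℤ.+ + 2 ℤ.≤ + s ℤ.+ + P
  h′ = subst (λ t → t ℤ.+ + ℓ ℤ.+ + 2 ℤ.≤ + s ℤ.+ + P) (ℤ.pos-* 2 M) (+≤+ h)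
  lhs : ∀ p m l s → p ℤ.+ m ℤ.+ + 4 ℤ.+ + 2 ℤ.* (l ℤ.- s)
                  ≡ (p ℤ.- + 3 ℤ.* m ℤ.- + 2 ℤ.* s) ℤ.+ + 2 ℤ.* (+ 2 ℤ.* m ℤ.+ l ℤ.+ + 2)
  lhs = solve-∀
  rhs : ∀ p m s → (p ℤ.- + 3 ℤ.* m ℤ.- + 2 ℤ.* s) ℤ.+ + 2 ℤ.* (s ℤ.+ p) ≡ + 3 ℤ.* (p ℤ.- m)
  rhs = solve-∀

other-vertex : ∀ {m} (v : Fin (suc (suc m))) → ∃ λ u → u ≢ v
other-vertex zero    = suc zero , λ ()
other-vertex (suc v) = zero , λ ()

corollary3p5 : (n : ℕ) → 2 ≤ n → (G : Graph n) → IsTree G →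
    (f : Fin n → ℤ) → IsSDF G f →
    + n ℤ.+ + 4 ℤ.+ + 2 ℤ.* (+ numLeaves G ℤ.- + numSupports G) ℤ.≤ + 3 ℤ.* weight f
corollary3p5 (suc (suc m)) (s≤s (s≤s _)) G (simple , connected , acyclic) f sdf =
  subst₂ (λ k w → + k ℤ.+ + 4 ℤ.+ + 2 ℤ.* (+ numLeaves G ℤ.- + numSupports G) ℤ.≤ + 3 ℤ.* w)
    (sym vertex-count) (sym weight-count)
    (signed-bound P M (numLeaves G) (numSupports G)
      (support-bound (degree-sum-acyclic (suc m) G simple acyclic)))
  where
  open SignedDominating G (proj₁ simple)
    (λ v → connected⇒degree≥1 G connected (proj₂ (other-vertex v))) sdf
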